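{- Let $n \ge 1$ and let $A[1..n]$ be an array of elements from a totally ordered set. Run the following procedure on $A$: for $i = 1, 2, \ldots, n$ (outer loop), and for each such $i$, for $j = 1, 2, \ldots, n$ (inner loop), if $A[i] < A[j]$ then swap the contents of $A[i]$ and $A[j]$. Then, when the procedure terminates, the array is sorted in non-decreasing order, i.e. $A[1] \le A[2] \le \cdots \le A[n]$.
   Context: The array is 1-indexed. The loops are executed in the standard nested order: the entire inner loop over $j=1,\ldots,n$ is executed for $i=1$, then for $i=2$, and so on; every comparison uses the current contents of the array. -}

module Defs where

open import Level using (Level)
open import Data.Nat using (ℕ; suc)
open import Data.Fin using (Fin; _≟_; toℕ)
open import Relation.Binary.PropositionalEquality using (_≡_)
open import Data.List using (List; foldl)
open import Data.List using () renaming (allFin to allFinL)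
open import Data.Sum using (_⊎_)
open import Relation.Nullary using (yes; no)
open import Relation.Binary.Bundles using (StrictTotalOrder)

module SortProc {c ℓ₁ ℓ₂ : Level} (O : StrictTotalOrder c ℓ₁ ℓ₂) where
  open StrictTotalOrder O using (Carrier; _≈_; _<_; _<?_)

  -- arrays A[1..n] are represented as functions Fin n → Carrier
  -- (Fin index k corresponds to the 1-based position k+1)
  Array : ℕ → Set c
  Array n = Fin n → Carrier

  swap : ∀ {n} → Array n → Fin n → Fin n → Array n
  swap A i j k with k ≟ i | k ≟ j
  ... | yes _ | _     = A j
  ... | no _  | yes _ = A i
  ... | no _  | no _  = A k

  step : ∀ {n} → Fin n → Array n → Fin n → Array n
  step i A j with A i <? A j
  ... | yes _ = swap A i j
  ... | no _  = A

  inner : ∀ {n} → Array n → Fin n → Array n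
  inner {n} A i = foldl (step i) A (allFinL n)

  procedure : ∀ {n} → Array n → Array n
  procedure {n} A = foldl inner A (allFinL n)

  _≤_ : Carrier → Carrier → Set _
  x ≤ y = (x < y) ⊎ (x ≈ y)

  Sorted : ∀ {n} → Array n → Set _
  Sorted {n} A = ∀ (k l : Fin n) → toℕ l ≡ suc (toℕ k) → A k ≤ A l

-- Before outer iteration i the prefix A[1..i-1] is sorted.  Throughout the
-- inner loop this prefix stays sorted and every A[q] with q < min(i, j) is
-- at most A[i].  For j < i a swap puts the old A[i] at position j, where it
-- lies between A[j-1] (bounded by the invariant) and the old A[j] ≤ A[j+1],
-- while the larger old A[j] becomes the new A[i].  For j > i a swap only
-- increases A[i] and leaves the prefix untouched.  At the end of the inner
-- loop every A[q] with q < i is at most A[i], so A[1..i] is sorted.  Unlike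
-- the usual argument, no maximum has to be tracked.
module Submission where

open import Defs
open import Level using (Level)
open import Data.Nat using (ℕ; _≥_)
open import Relation.Binary.Bundles using (StrictTotalOrder)

import Data.Nat as ℕ
import Data.Nat.Properties as ℕ
open import Data.Fin as Fin using (Fin; zero; suc; toℕ; _≟_)
open import Data.Fin.Properties using (toℕ<n; <-cmp; <⇒≢; ≤∧≢⇒<)
open import Data.List using (foldl; tabulate)
open import Data.Product using (_×_; _,_; proj₁; proj₂)
open import Data.Sum using (inj₁; inj₂)
open import Data.Empty using (⊥-elim)
open import Function using (id)
open import Relation.Nullary using (¬_; yes; no)
open import Relation.Nullary.Decidable using (toSum)
open import Relation.Binary.PropositionalEquality using (_≡_; _≢_; refl; sym)
open import Relation.Binary.Definitions using (tri<; tri≈; tri>)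
import Relation.Binary.Construct.StrictToNonStrict as NonStrict

foldl-tabulate-induction : ∀ {a b p} {S : Set a} {X : Set b} (f : S → X → S) {m : ℕ}
  (h : Fin m → X) (P : ℕ → S → Set p) →
  (∀ k s → P (toℕ k) s → P (ℕ.suc (toℕ k)) (f s (h k))) →
  ∀ s → P 0 s → P m (foldl f s (tabulate h))
foldl-tabulate-induction f {ℕ.zero} h P step s p = p
foldl-tabulate-induction f {ℕ.suc m} h P step s p =
  foldl-tabulate-induction f (λ k → h (suc k)) (λ k → P (ℕ.suc k)) (λ k → step (suc k))
    (f s (h zero)) (step zero s p)

consecutive⇒< : ∀ {n} {k l : Fin n} → toℕ l ≡ ℕ.suc (toℕ k) → k Fin.< l
consecutive⇒< l≡1+k = ℕ.≤-reflexive (sym l≡1+k)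

<-suc∧≢⇒< : ∀ {n} {q j : Fin n} → toℕ q ℕ.< ℕ.suc (toℕ j) → q ≢ j → q Fin.< j
<-suc∧≢⇒< q<1+j q≢j = ≤∧≢⇒< (ℕ.s≤s⁻¹ q<1+j) q≢j

module _ {c ℓ₁ ℓ₂ : Level} (O : StrictTotalOrder c ℓ₁ ℓ₂) where
  open SortProc O
  open StrictTotalOrder O using (_≈_; _<_; _<?_; compare; irrefl; <-resp-≈; module Eq)
    renaming (trans to <-trans)

  <-≤-trans : ∀ {x y z} → x < y → y ≤ z → x < z
  <-≤-trans = NonStrict.<-≤-trans _≈_ _<_ <-trans (proj₁ <-resp-≈)

  ≤-<-trans : ∀ {x y z} → x ≤ y → y < z → x < z
  ≤-<-trans = NonStrict.≤-<-trans _≈_ _<_ Eq.sym <-trans (proj₂ <-resp-≈)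

  ≮⇒≥ : ∀ {x y} → ¬ (x < y) → y ≤ x
  ≮⇒≥ {x} {y} x≮y with compare x y
  ... | tri< x<y _ _ = ⊥-elim (x≮y x<y)
  ... | tri≈ _ x≈y _ = inj₂ (Eq.sym x≈y)
  ... | tri> _ _ y<x = inj₁ y<x

  swap-first : ∀ {n} (B : Array n) i j → swap B i j i ≡ B j
  swap-first B i j with i ≟ i
  ... | yes _   = refl
  ... | no i≢i = ⊥-elim (i≢i refl)

  swap-second : ∀ {n} (B : Array n) {i j} → i ≢ j → swap B i j j ≡ B i
  swap-second B {i} {j} i≢j with j ≟ i | j ≟ j
  ... | yes j≡i | _       = ⊥-elim (i≢j (sym j≡i))
  ... | no _    | yes _   = refl
  ... | no _    | no j≢j = ⊥-elim (j≢j refl)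

  swap-other : ∀ {n} (B : Array n) {i j k} → k ≢ i → k ≢ j → swap B i j k ≡ B k
  swap-other B {i} {j} {k} k≢i k≢j with k ≟ i | k ≟ j
  ... | yes k≡i | _       = ⊥-elim (k≢i k≡i)
  ... | no _    | yes k≡j = ⊥-elim (k≢j k≡j)
  ... | no _    | no _    = refl

  SortedBelow : ∀ {n} → ℕ → Array n → Set _
  SortedBelow {n} t B = ∀ (k l : Fin n) → toℕ l ≡ ℕ.suc (toℕ k) → toℕ l ℕ.< t → B k ≤ B l

  sortedBelow-extend : ∀ {n} {B : Array n} {i} → SortedBelow (toℕ i) B →
    (∀ q → q Fin.< i → B q ≤ B i) → SortedBelow (ℕ.suc (toℕ i)) B
  sortedBelow-extend {i = i} sorted bounded k l l≡1+k l<1+i with l ≟ i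
  ... | no l≢i   = sorted k l l≡1+k (<-suc∧≢⇒< l<1+i l≢i)
  ... | yes refl = bounded k (consecutive⇒< l≡1+k)

  module InnerLoop {n} (i : Fin n) where

    Invariant : ℕ → Array n → Set _
    Invariant j B = SortedBelow (toℕ i) B × (∀ q → q Fin.< i → toℕ q ℕ.< j → B q ≤ B i)

    invariant-keep : ∀ j B → ¬ (B i < B j) →
      Invariant (toℕ j) B → Invariant (ℕ.suc (toℕ j)) B
    invariant-keep j B Bi≮Bj (sorted , bounded) = sorted , bounded′
      where
      bounded′ : ∀ q → q Fin.< i → toℕ q ℕ.< ℕ.suc (toℕ j) → B q ≤ B i
      bounded′ q q<i q<1+j with q ≟ j
      ... | yes refl = ≮⇒≥ Bi≮Bj
      ... | no q≢j   = bounded q q<i (<-suc∧≢⇒< q<1+j q≢j)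

    invariant-swap-below : ∀ {j} B → j Fin.< i → B i < B j →
      Invariant (toℕ j) B → Invariant (ℕ.suc (toℕ j)) (swap B i j)
    invariant-swap-below {j} B j<i Bi<Bj (sorted , bounded) = sorted′ , bounded′
      where
      i≢j : i ≢ j
      i≢j i≡j = <⇒≢ j<i (sym i≡j)

      unchanged : ∀ {q} → q Fin.< i → q ≢ j → swap B i j q ≡ B q
      unchanged q<i = swap-other B (<⇒≢ q<i)

      -- toSum: a plain `with k ≟ j` would also abstract the same test inside swap.
      sorted′ : SortedBelow (toℕ i) (swap B i j)
      sorted′ k l l≡1+k l<i with toSum (k ≟ j) | toSum (l ≟ j)
      ... | inj₁ refl | _
          rewrite swap-second B i≢j | unchanged l<i (λ l≡k → <⇒≢ (consecutive⇒< l≡1+k) (sym l≡k))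
          = inj₁ (<-≤-trans Bi<Bj (sorted k l l≡1+k l<i))
      ... | inj₂ k≢j | inj₁ refl
          rewrite swap-second B i≢j | unchanged (ℕ.<-trans (consecutive⇒< l≡1+k) l<i) k≢j
          = bounded k (ℕ.<-trans (consecutive⇒< l≡1+k) l<i) (consecutive⇒< l≡1+k)
      ... | inj₂ k≢j | inj₂ l≢j
          rewrite unchanged l<i l≢j | unchanged (ℕ.<-trans (consecutive⇒< l≡1+k) l<i) k≢j
          = sorted k l l≡1+k l<i

      bounded′ : ∀ q → q Fin.< i → toℕ q ℕ.< ℕ.suc (toℕ j) → swap B i j q ≤ swap B i j i
      bounded′ q q<i q<1+j rewrite swap-first B i j with toSum (q ≟ j)
      ... | inj₁ refl rewrite swap-second B i≢j = inj₁ Bi<Bj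
      ... | inj₂ q≢j rewrite unchanged q<i q≢j =
        inj₁ (≤-<-trans (bounded q q<i (<-suc∧≢⇒< q<1+j q≢j)) Bi<Bj)

    invariant-swap-above : ∀ {j} B → i Fin.< j → B i < B j →
      Invariant (toℕ j) B → Invariant (ℕ.suc (toℕ j)) (swap B i j)
    invariant-swap-above {j} B i<j Bi<Bj (sorted , bounded) = sorted′ , bounded′
      where
      below-i-unchanged : ∀ {q} → q Fin.< i → swap B i j q ≡ B q
      below-i-unchanged q<i = swap-other B (<⇒≢ q<i) (<⇒≢ (ℕ.<-trans q<i i<j))

      sorted′ : SortedBelow (toℕ i) (swap B i j)
      sorted′ k l l≡1+k l<i
        rewrite below-i-unchanged l<i
              | below-i-unchanged (ℕ.<-trans (consecutive⇒< l≡1+k) l<i)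
        = sorted k l l≡1+k l<i

      bounded′ : ∀ q → q Fin.< i → toℕ q ℕ.< ℕ.suc (toℕ j) → swap B i j q ≤ swap B i j i
      bounded′ q q<i _ rewrite swap-first B i j | below-i-unchanged q<i =
        inj₁ (≤-<-trans (bounded q q<i (ℕ.<-trans q<i i<j)) Bi<Bj)

    invariant-step : ∀ j B → Invariant (toℕ j) B → Invariant (ℕ.suc (toℕ j)) (step i B j)
    invariant-step j B inv with B i <? B j | <-cmp j i
    ... | no Bi≮Bj  | _            = invariant-keep j B Bi≮Bj inv
    ... | yes Bi<Bj | tri< j<i _ _ = invariant-swap-below B j<i Bi<Bj inv
    ... | yes Bi<Bi | tri≈ _ refl _ = ⊥-elim (irrefl Eq.refl Bi<Bi)
    ... | yes Bi<Bj | tri> _ _ i<j = invariant-swap-above B i<j Bi<Bj inv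

    inner-extends-sorted : ∀ B → SortedBelow (toℕ i) B → SortedBelow (ℕ.suc (toℕ i)) (inner B i)
    inner-extends-sorted B sorted with foldl-tabulate-induction (step i) id Invariant invariant-step
                                         B (sorted , λ _ _ ())
    ... | sorted′ , bounded = sortedBelow-extend sorted′ (λ q q<i → bounded q q<i (toℕ<n q))

  procedure-sorted : ∀ {n} (A : Array n) → Sorted (procedure A)
  procedure-sorted A k l l≡1+k =
    foldl-tabulate-induction inner id SortedBelow (λ i → InnerLoop.inner-extends-sorted i)
      A (λ _ _ _ ()) k l l≡1+k (toℕ<n l)

mainTheorem1 : {c ℓ₁ ℓ₂ : Level} (O : StrictTotalOrder c ℓ₁ ℓ₂) (n : ℕ) → n ≥ 1 →
    (A : SortProc.Array O n) → SortProc.Sorted O (SortProc.procedure O A)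
mainTheorem1 O n _ = procedure-sorted O
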